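{- For every integer $k\ge 2$, $\chi_{DP}(C_{3k}^2)>3$.
   Context: $C_n$ is the cycle on $n$ vertices and $C_n^2$ is its square (same vertex set, two vertices adjacent iff their distance in $C_n$ is at most $2$). A cover of a graph $G$ is a pair $\mathcal{H}=(L,H)$ where $H$ is a graph and $L:V(G)\to\mathcal{P}(V(H))$ satisfies: (1) $\{L(u)\}$ partitions $V(H)$; (2) each $H[L(u)]$ is complete; (3) if $E_H(L(u),L(v))\neq\emptyset$ then $u=v$ or $uv\in E(G)$; (4) if $uv\in E(G)$ then $E_H(L(u),L(v))$ is a matching (possibly empty). An $\mathcal{H}$-coloring is an independent set of $H$ of size $|V(G)|$. The cover is $m$-fold if $|L(u)|=m$ for all $u$. $\chi_{DP}(G)$ is the least $m\in\mathbb{N}$ such that $G$ has an $\mathcal{H}$-coloring for every $m$-fold cover $\mathcal{H}$. -}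

module Defs where

open import Level using (0ℓ; suc)
open import Data.Nat using (ℕ; _≤_; _<_; _∸_; _*_; ∣_-_∣)
open import Data.Fin using (Fin; toℕ)
open import Data.Product using (_×_; _,_)
open import Data.Sum using (_⊎_)
open import Relation.Nullary using (¬_)
open import Relation.Binary.PropositionalEquality using (_≡_; _≢_)

-- Square of the cycle C_n on vertex set {0,…,n-1}: u ~ v iff u ≠ v and the
-- cyclic distance min(|u-v|, n-|u-v|) is at most 2.
CycleSq : (n : ℕ) → Fin n → Fin n → Set
CycleSq n u v = (0 < ∣ toℕ u - toℕ v ∣) × (∣ toℕ u - toℕ v ∣ ≤ 2 ⊎ n ∸ ∣ toℕ u - toℕ v ∣ ≤ 2)

-- Up to renaming the vertices of H, we take V(H) = Fin n × Fin m with
-- L(u) = {u} × Fin m (so the L(u) partition V(H) and |L(u)| = m).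
record Cover (n : ℕ) (Adj : Fin n → Fin n → Set) (m : ℕ) : Set₁ where
  field
    EH     : Fin n × Fin m → Fin n × Fin m → Set
    EH-sym : ∀ x y → EH x y → EH y x
    EH-irr : ∀ x → ¬ EH x x
    clique : ∀ u i j → i ≢ j → EH (u , i) (u , j)
    edges-in-G : ∀ u v i j → u ≢ v → EH (u , i) (v , j) → Adj u v
    matching   : ∀ u v → Adj u v → u ≢ v → ∀ i j j′ →
                 EH (u , i) (v , j) → EH (u , i) (v , j′) → j ≡ j′

open Cover public

-- An H-coloring: an independent set of H of size |V(G)| = n, given as an
-- injective enumeration Fin n → V(H) of pairwise non-adjacent vertices.
record HColoring {n : ℕ} {Adj : Fin n → Fin n → Set} {m : ℕ}
                 (H : Cover n Adj m) : Set where
  field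
    elt   : Fin n → Fin n × Fin m
    inj   : ∀ a b → elt a ≡ elt b → a ≡ b
    indep : ∀ a b → ¬ EH H (elt a) (elt b)

DPColorable : (n : ℕ) → (Fin n → Fin n → Set) → ℕ → Set₁
DPColorable n Adj m = (H : Cover n Adj m) → HColoring H

χDP> : (n : ℕ) → (Fin n → Fin n → Set) → ℕ → Set₁
χDP> n Adj c = ∀ m → m ≤ c → ¬ DPColorable n Adj m

-- An H-colouring of a cover whose matchings E_H(L(u), L(v)), u < v, are
-- graphs of permutations σ_uv of the colours yields a map c with
-- c v ≢ σ_uv (c u) on every edge uv. With every σ_uv = id these are proper
-- colourings, and the triangle {0, 1, 2} of C²_n rules out fewer than three colours.
-- For three colours, let σ_uv be the rotation of Fin 3 on the edges from 0 to
-- n-2 and n-1, and the identity elsewhere. Every other edge joins vertices at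
-- distance at most 2 along the path 0, 1, …, n-1, so any three consecutive
-- colours are distinct and the colouring is 3-periodic; as 3 ∣ n, the vertices
-- n-2 and n-1 repeat the colours y, z of 1 and 2. Then y, z avoid both the
-- colour x of 0 and its rotation, and y ≢ z: impossible in Fin 3.
module Submission where

open import Defs
open import Data.Nat using (ℕ; _≤_; _*_)
open import Data.Nat using (zero; suc; _+_; _∸_; _<_; z≤n; s≤s; z<s; s<s; _<?_)
import Data.Nat.Properties as ℕ
open import Data.Fin using (Fin; zero; suc; toℕ; fromℕ<; punchOut)
import Data.Fin as Fin
import Data.Fin.Properties as Finₚ
open import Data.Vec using ([]; _∷_; lookup)
open import Data.Product using (Σ-syntax; ∃; _×_; _,_; proj₁; proj₂)
open import Data.Sum using (_⊎_; inj₁; inj₂; [_,_]′)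
import Data.Sum as Sum
open import Data.Empty using (⊥-elim)
open import Function using (_∘_; id)
open import Function.Definitions using (Injective)
open import Relation.Nullary using (¬_; yes; no; contradiction)
open import Relation.Binary.PropositionalEquality
  using (_≡_; _≢_; refl; sym; trans; cong; cong₂; subst; subst₂; ≢-sym)

injective⇒surjective : ∀ {n} {f : Fin n → Fin n} → Injective _≡_ _≡_ f →
                       ∀ u → ∃ λ a → f a ≡ u
injective⇒surjective {suc n} {f} f-injective u with Finₚ.any? (λ a → f a Finₚ.≟ u)
... | yes hit = hit
... | no miss = contradiction (Finₚ.injective⇒≤ punchOut-injective) ℕ.1+n≰n
  where
  avoids : ∀ a → u ≢ f a
  avoids a u≡fa = miss (a , sym u≡fa)

  punchOut-injective : Injective _≡_ _≡_ (λ a → punchOut (avoids a))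
  punchOut-injective eq = f-injective (Finₚ.punchOut-injective (avoids _) (avoids _) eq)

Distinct₃ : {A : Set} → A → A → A → Set
Distinct₃ x y z = x ≢ y × x ≢ z × y ≢ z

distinct₃-injective : {A : Set} {x y z : A} → Distinct₃ x y z →
                      Injective _≡_ _≡_ (lookup (x ∷ y ∷ z ∷ []))
distinct₃-injective _             {zero}           {zero}           _ = refl
distinct₃-injective (x≢y , _ , _) {zero}           {suc zero}       e = ⊥-elim (x≢y e)
distinct₃-injective (_ , x≢z , _) {zero}           {suc (suc zero)} e = ⊥-elim (x≢z e)
distinct₃-injective (x≢y , _ , _) {suc zero}       {zero}           e = ⊥-elim (x≢y (sym e))
distinct₃-injective _             {suc zero}       {suc zero}       _ = refl
distinct₃-injective (_ , _ , y≢z) {suc zero}       {suc (suc zero)} e = ⊥-elim (y≢z e)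
distinct₃-injective (_ , x≢z , _) {suc (suc zero)} {zero}           e = ⊥-elim (x≢z (sym e))
distinct₃-injective (_ , _ , y≢z) {suc (suc zero)} {suc zero}       e = ⊥-elim (y≢z (sym e))
distinct₃-injective _             {suc (suc zero)} {suc (suc zero)} _ = refl

distinct₃⇒3≤ : ∀ {m} {x y z : Fin m} → Distinct₃ x y z → 3 ≤ m
distinct₃⇒3≤ d = Finₚ.injective⇒≤ (distinct₃-injective d)

distinct₃-exhaustive : {x y z : Fin 3} → Distinct₃ x y z →
                       ∀ w → w ≡ x ⊎ w ≡ y ⊎ w ≡ z
distinct₃-exhaustive d w with injective⇒surjective (distinct₃-injective d) w
... | zero           , x≡w = inj₁ (sym x≡w)
... | suc zero       , y≡w = inj₂ (inj₁ (sym y≡w))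
... | suc (suc zero) , z≡w = inj₂ (inj₂ (sym z≡w))

rotate : Fin 3 → Fin 3
rotate zero             = suc zero
rotate (suc zero)       = suc (suc zero)
rotate (suc (suc zero)) = zero

rotate³ : ∀ x → rotate (rotate (rotate x)) ≡ x
rotate³ zero             = refl
rotate³ (suc zero)       = refl
rotate³ (suc (suc zero)) = refl

rotate-injective : Injective _≡_ _≡_ rotate
rotate-injective {x} {y} eq =
  trans (sym (rotate³ x)) (trans (cong (rotate ∘ rotate) eq) (rotate³ y))

rotate-fixpoint-free : ∀ x → x ≢ rotate x
rotate-fixpoint-free zero             ()
rotate-fixpoint-free (suc zero)       ()
rotate-fixpoint-free (suc (suc zero)) ()

colouring⇒choice : ∀ {n m Adj} {H : Cover n Adj m} → HColoring H →
                   Σ[ c ∈ (Fin n → Fin m) ] (∀ u v → ¬ EH H (u , c u) (v , c v))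
colouring⇒choice {n} {m} {H = H} κ = colour , independent
  where
  open HColoring κ

  vertex-injective : Injective _≡_ _≡_ (proj₁ ∘ elt)
  vertex-injective {a} {b} u≡v with proj₂ (elt a) Finₚ.≟ proj₂ (elt b)
  ... | yes i≡j = inj a b (cong₂ _,_ u≡v i≡j)
  ... | no i≢j = ⊥-elim (indep a b
    (subst (λ v → EH H (proj₁ (elt a) , proj₂ (elt a)) (v , proj₂ (elt b))) u≡v
      (clique H _ _ _ i≢j)))

  chosen : ∀ u → ∃ λ a → proj₁ (elt a) ≡ u
  chosen = injective⇒surjective vertex-injective

  colour : Fin n → Fin m
  colour u = proj₂ (elt (proj₁ (chosen u)))

  independent : ∀ u v → ¬ EH H (u , colour u) (v , colour v)
  independent u v = subst₂ (λ u′ v′ → ¬ EH H (u′ , colour u) (v′ , colour v))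
    (proj₂ (chosen u)) (proj₂ (chosen v)) (indep (proj₁ (chosen u)) (proj₁ (chosen v)))

TwistedColouring : ∀ {n m} → (Fin n → Fin n → Set) →
                   (Fin n → Fin n → Fin m → Fin m) → (Fin n → Fin m) → Set
TwistedColouring Adj σ c = ∀ {u v} → Adj u v → u Fin.< v → c v ≢ σ u v (c u)

module TwistedCover {n m : ℕ} {Adj : Fin n → Fin n → Set} (Adj-sym : ∀ u v → Adj u v → Adj v u)
                    (σ : Fin n → Fin n → Fin m → Fin m)
                    (σ-injective : ∀ u v → Injective _≡_ _≡_ (σ u v)) where

  Twisted : Fin n → Fin n → Fin m → Fin m → Set
  Twisted u v i j = (u Fin.< v × j ≡ σ u v i) ⊎ (v Fin.< u × i ≡ σ v u j)

  Edge : Fin n × Fin m → Fin n × Fin m → Set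
  Edge (u , i) (v , j) = (u ≡ v × i ≢ j) ⊎ (Adj u v × Twisted u v i j)

  twisted-irrefl : ∀ {u i j} → ¬ Twisted u u i j
  twisted-irrefl (inj₁ (u<u , _)) = Finₚ.<-irrefl refl u<u
  twisted-irrefl (inj₂ (u<u , _)) = Finₚ.<-irrefl refl u<u

  twisted-functional : ∀ {u v i j j′} → Twisted u v i j → Twisted u v i j′ → j ≡ j′
  twisted-functional (inj₁ (_ , j≡σi)) (inj₁ (_ , j′≡σi)) = trans j≡σi (sym j′≡σi)
  twisted-functional (inj₂ (_ , i≡σj)) (inj₂ (_ , i≡σj′)) =
    σ-injective _ _ (trans (sym i≡σj) i≡σj′)
  twisted-functional (inj₁ (u<v , _)) (inj₂ (v<u , _)) = ⊥-elim (Finₚ.<-asym u<v v<u)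
  twisted-functional (inj₂ (v<u , _)) (inj₁ (u<v , _)) = ⊥-elim (Finₚ.<-asym u<v v<u)

  edge-sym : ∀ x y → Edge x y → Edge y x
  edge-sym _ _ (inj₁ (refl , i≢j)) = inj₁ (refl , ≢-sym i≢j)
  edge-sym _ _ (inj₂ (adj , t))    = inj₂ (Adj-sym _ _ adj , Sum.swap t)

  edge-irrefl : ∀ x → ¬ Edge x x
  edge-irrefl _ (inj₁ (_ , i≢i)) = i≢i refl
  edge-irrefl _ (inj₂ (_ , t))   = twisted-irrefl t

  edge⇒adjacent : ∀ u v i j → u ≢ v → Edge (u , i) (v , j) → Adj u v
  edge⇒adjacent _ _ _ _ u≢v (inj₁ (u≡v , _)) = ⊥-elim (u≢v u≡v)
  edge⇒adjacent _ _ _ _ _   (inj₂ (adj , _)) = adj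

  edge-matching : ∀ u v → Adj u v → u ≢ v → ∀ i j j′ →
                  Edge (u , i) (v , j) → Edge (u , i) (v , j′) → j ≡ j′
  edge-matching _ _ _ u≢v _ _ _ (inj₁ (u≡v , _)) _                = ⊥-elim (u≢v u≡v)
  edge-matching _ _ _ u≢v _ _ _ (inj₂ _)         (inj₁ (u≡v , _)) = ⊥-elim (u≢v u≡v)
  edge-matching _ _ _ _   _ _ _ (inj₂ (_ , t))   (inj₂ (_ , t′))  = twisted-functional t t′

  cover : Cover n Adj m
  cover = record
    { EH         = Edge
    ; EH-sym     = edge-sym
    ; EH-irr     = edge-irrefl
    ; clique     = λ _ _ _ i≢j → inj₁ (refl , i≢j)
    ; edges-in-G = edge⇒adjacent
    ; matching   = edge-matching
    }

  colouring⇒twistedColouring : HColoring cover → ∃ (TwistedColouring Adj σ)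
  colouring⇒twistedColouring κ with colouring⇒choice κ
  ... | c , independent =
    c , λ adj u<v eq → independent _ _ (inj₂ (adj , inj₁ (u<v , eq)))

triangle⇒3≤ : ∀ {n m} {Adj : Fin n → Fin n → Set} → (∀ u v → Adj u v → Adj v u) →
              ∀ {x y z} → Adj x y → Adj x z → Adj y z → x Fin.< y → y Fin.< z →
              DPColorable n Adj m → 3 ≤ m
triangle⇒3≤ {m = m} {Adj} Adj-sym xy xz yz x<y y<z colourable =
  three-colours (colouring⇒twistedColouring (colourable cover))
  where
  open TwistedCover Adj-sym (λ _ _ → id) (λ _ _ → id)

  three-colours : ∃ (TwistedColouring Adj (λ _ _ → id)) → 3 ≤ m
  three-colours (c , proper) = distinct₃⇒3≤
    ( ≢-sym (proper xy x<y)
    , ≢-sym (proper xz (Finₚ.<-trans x<y y<z))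
    , ≢-sym (proper yz y<z) )

CycleSq-sym : ∀ {n} u v → CycleSq n u v → CycleSq n v u
CycleSq-sym u v adj rewrite ℕ.∣-∣-comm (toℕ u) (toℕ v) = adj

CycleSq-χDP>2 : ∀ n → χDP> (3 + n) (CycleSq (3 + n)) 2
CycleSq-χDP>2 n m m≤2 colourable = ℕ.≤⇒≯ three≤m (s≤s m≤2)
  where
  three≤m : 3 ≤ m
  three≤m = triangle⇒3≤ CycleSq-sym {x = zero} {y = suc zero} {z = suc (suc zero)}
    (z<s , inj₁ (s≤s z≤n)) (z<s , inj₁ (s≤s (s≤s z≤n))) (z<s , inj₁ (s≤s z≤n))
    z<s (s<s z<s) colourable

-- The permutation on the edge a < b; for n ≥ 6 the only neighbours b ≥ 3 of 0 are n-2, n-1.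
twist : ℕ → ℕ → Fin 3 → Fin 3
twist zero (suc (suc (suc _))) = rotate
twist _    _                   = id

twist-injective : ∀ a b → Injective _≡_ _≡_ (twist a b)
twist-injective zero    (suc (suc (suc _))) = rotate-injective
twist-injective zero    zero                = id
twist-injective zero    (suc zero)          = id
twist-injective zero    (suc (suc zero))    = id
twist-injective (suc _) _                   = id

twist-short : ∀ {a b} → b ≤ 2 + a → twist a b ≡ id
twist-short {suc _}                    _ = refl
twist-short {zero} {zero}              _ = refl
twist-short {zero} {suc zero}          _ = refl
twist-short {zero} {suc (suc zero)}    _ = refl
twist-short {zero} {suc (suc (suc _))} (s≤s (s≤s ()))

module Periodic {n : ℕ} {c : Fin n → Fin 3}
                (proper : TwistedColouring (CycleSq n) (λ u v → twist (toℕ u) (toℕ v)) c)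
                where

  -- c read on the labels 0, 1, … of the vertices; the junk value beyond n is never used.
  colour : ℕ → Fin 3
  colour a with a <? n
  ... | yes a<n = c (fromℕ< a<n)
  ... | no _    = zero

  colour-fromℕ< : ∀ {a} (a<n : a < n) → colour a ≡ c (fromℕ< a<n)
  colour-fromℕ< {a} a<n with a <? n
  ... | yes _   = refl
  ... | no a≮n = contradiction a<n a≮n

  below : ∀ k {b} → k + b < n → b < n
  below k {b} = ℕ.≤-<-trans (ℕ.m≤n+m b k)

  colour-adjacent : ∀ {a b} → a < b → b < n → b ∸ a ≤ 2 ⊎ n ∸ (b ∸ a) ≤ 2 →
                    colour b ≢ twist a b (colour a)
  colour-adjacent {a} {b} a<b b<n short eq = proper adjacent u<v twisted
    where
    a<n = ℕ.<-trans a<b b<n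
    u = fromℕ< a<n
    v = fromℕ< b<n

    adjacent : CycleSq n u v
    adjacent rewrite Finₚ.toℕ-fromℕ< a<n | Finₚ.toℕ-fromℕ< b<n
                   | ℕ.m≤n⇒∣m-n∣≡n∸m (ℕ.<⇒≤ a<b) = ℕ.m<n⇒0<n∸m a<b , short

    u<v : u Fin.< v
    u<v rewrite Finₚ.toℕ-fromℕ< a<n | Finₚ.toℕ-fromℕ< b<n = a<b

    twisted : c v ≡ twist (toℕ u) (toℕ v) (c u)
    twisted rewrite Finₚ.toℕ-fromℕ< a<n | Finₚ.toℕ-fromℕ< b<n =
      trans (sym (colour-fromℕ< b<n)) (trans eq (cong (twist a b) (colour-fromℕ< a<n)))

  colour-near : ∀ a d → 0 < d → d ≤ 2 → d + a < n → colour (d + a) ≢ colour a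
  colour-near a d 0<d d≤2 d+a<n eq =
    colour-adjacent (ℕ.m<n+m a 0<d) d+a<n (inj₁ length≤2)
      (trans eq (cong (λ τ → τ (colour a)) (sym (twist-short (ℕ.+-monoˡ-≤ a d≤2)))))
    where
    length≤2 : d + a ∸ a ≤ 2
    length≤2 = subst (_≤ 2) (sym (ℕ.m+n∸n≡m d a)) d≤2

  colour-step : ∀ a → 3 + a < n → colour (3 + a) ≡ colour a
  colour-step a 3+a<n =
    [ id , [ ⊥-elim ∘ colour-near (1 + a) 2 z<s (s≤s (s≤s z≤n)) 3+a<n
           , ⊥-elim ∘ colour-near (2 + a) 1 z<s (s≤s z≤n) 3+a<n ]′ ]′
    (distinct₃-exhaustive distinct (colour (3 + a)))
    where
    distinct : Distinct₃ (colour a) (colour (1 + a)) (colour (2 + a))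
    distinct = ≢-sym (colour-near a 1 z<s (s≤s z≤n) (below 2 3+a<n))
             , ≢-sym (colour-near a 2 z<s (s≤s (s≤s z≤n)) (below 1 3+a<n))
             , ≢-sym (colour-near (1 + a) 1 z<s (s≤s z≤n) (below 1 3+a<n))

  colour-periodic : ∀ t r → t * 3 + r < n → colour (t * 3 + r) ≡ colour r
  colour-periodic zero    r _ = refl
  colour-periodic (suc t) r p =
    trans (colour-step (t * 3 + r) p) (colour-periodic t r (below 3 p))

wrap-short : ∀ X r → (3 + X) ∸ (X + suc r) ≤ 2
wrap-short X r rewrite ℕ.+-comm 3 X | ℕ.[m+n]∸[m+o]≡n∸o X 3 (suc r) = ℕ.m∸n≤m 2 r

wrap-bound : ∀ X {r} → r < 3 → X + r < 3 + X
wrap-bound X {r} r<3 = subst (_< 3 + X) (ℕ.+-comm r X) (ℕ.+-monoˡ-< X r<3)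

no-twisted-3-colouring :
  ∀ k {c : Fin (suc (suc k) * 3) → Fin 3} →
  ¬ TwistedColouring (CycleSq (suc (suc k) * 3)) (λ u v → twist (toℕ u) (toℕ v)) c
no-twisted-3-colouring k proper =
  [ x≢z ∘ sym , [ twisted-edge 1 (s<s z<s) , y≢z ∘ sym ]′ ]′
  (distinct₃-exhaustive (rotate-fixpoint-free x , x≢y , ≢-sym (twisted-edge 0 z<s)) z)
  where
  open Periodic proper
  X = suc k * 3
  x = colour 0
  y = colour 1
  z = colour 2

  x≢y : x ≢ y
  x≢y = ≢-sym (colour-near 0 1 z<s (s≤s z≤n) (s≤s (s≤s z≤n)))

  x≢z : x ≢ z
  x≢z = ≢-sym (colour-near 0 2 z<s (s≤s (s≤s z≤n)) (s≤s (s≤s (s≤s z≤n))))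

  y≢z : y ≢ z
  y≢z = ≢-sym (colour-near 1 1 z<s (s≤s z≤n) (s≤s (s≤s (s≤s z≤n))))

  -- The edges from 0 to X + 1 = n-2 and X + 2 = n-1, whose twist is rotate.
  twisted-edge : ∀ r → r < 2 → colour (suc r) ≢ rotate x
  twisted-edge r r<2 = colour-adjacent z<s X+r<n (inj₂ (wrap-short X r))
                     ∘ trans (colour-periodic (suc k) (suc r) X+r<n)
    where
    X+r<n = wrap-bound X (s≤s r<2)

CycleSq-¬DPColorable-3 : ∀ k → ¬ DPColorable (suc (suc k) * 3) (CycleSq (suc (suc k) * 3)) 3
CycleSq-¬DPColorable-3 k colourable =
  no-twisted-3-colouring k (proj₂ (colouring⇒twistedColouring (colourable cover)))
  where
  open TwistedCover CycleSq-sym (λ u v → twist (toℕ u) (toℕ v))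
                    (λ u v → twist-injective (toℕ u) (toℕ v))

proposition3p5 : (k : ℕ) → 2 ≤ k → χDP> (3 * k) (CycleSq (3 * k)) 3
proposition3p5 (suc zero) (s≤s ())
proposition3p5 (suc (suc k)) _ m m≤3 =
  subst (λ n → ¬ DPColorable n (CycleSq n) m) (ℕ.*-comm (suc (suc k)) 3) not-colourable
  where
  not-colourable : ¬ DPColorable (suc (suc k) * 3) (CycleSq (suc (suc k) * 3)) m
  not-colourable with ℕ.m≤n⇒m<n∨m≡n m≤3
  ... | inj₁ m<3  = CycleSq-χDP>2 (suc k * 3) m (ℕ.≤-pred m<3)
  ... | inj₂ refl = CycleSq-¬DPColorable-3 k
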